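{- For all integers $k\ge 3$, $c_{K_k} \le \frac{1}{k+1}$. More precisely, for every $\varepsilon>0$ there exist $\delta>0$ and graphs $G$ with arbitrarily large number $n$ of vertices and minimum degree at least $n\left(1-\frac{1}{k+1}\right)-\varepsilon n$ for which $\nu^*_{K_k}(G) \le (1-\delta)\, e(G)/\binom{k}{2}$.
   Context: All graphs are finite, undirected and simple; $K_k$ is the complete graph on $k$ vertices, $e(G)$ the number of edges. For a graph $H$, $\nu_H(G)$ is the maximum number of pairwise edge-disjoint copies of $H$ in $G$. A fractional $H$-packing of $G$ is a function $\psi$ from the copies of $H$ in $G$ to $[0,1]$ such that for each edge $e$ of $G$, the sum of $\psi$ over copies containing $e$ is at most $1$; $\nu^*_H(G)$ is the maximum of $\sum\psi$ over fractional $H$-packings. $c_H$ is the supremum of all $c$ such that for every $\varepsilon'>0$ there is $n_0$ such that every graph $G$ on $n\ge n_0$ vertices with $\delta(G)\ge(1-c)(n-1)$ satisfies $\nu_H(G)\ge(1-\varepsilon')e(G)/e(H)$. -}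

module Defs where

open import Data.Bool using (Bool; true; false; _∧_; _∨_; not)
open import Data.Nat using (ℕ; zero; suc; _<ᵇ_; _≡ᵇ_)
open import Data.Fin using (Fin; toℕ)
open import Data.Vec using (Vec; []; _∷_; lookup)
open import Data.List using (List; []; _∷_; map; _++_; filterᵇ; length; allFin; foldr; concatMap)
open import Data.Product using (_×_; _,_)
open import Data.Bool.ListAction using (all)
open import Data.Fin.Subset using (Subset; ∣_∣)
open import Data.Integer using (+_)
open import Data.Rational using (ℚ; _/_; _+_; _≤_; 0ℚ; 1ℚ)
open import Relation.Binary.PropositionalEquality using (_≡_)

record Graph (n : ℕ) : Set where
  field
    adj    : Fin n → Fin n → Bool
    sym    : ∀ i j → adj i j ≡ adj j i
    irrefl : ∀ i → adj i i ≡ false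
open Graph public

ℕ→ℚ : ℕ → ℚ
ℕ→ℚ m = + m / 1

sumℚ : List ℚ → ℚ
sumℚ = foldr _+_ 0ℚ

allSubsets : (n : ℕ) → List (Subset n)
allSubsets zero    = [] ∷ []
allSubsets (suc n) = map (true ∷_) (allSubsets n) ++ map (false ∷_) (allSubsets n)

allPairs : (n : ℕ) → List (Fin n × Fin n)
allPairs n = concatMap (λ i → map (i ,_) (allFin n)) (allFin n)

module _ {n : ℕ} (G : Graph n) where

  degree : Fin n → ℕ
  degree v = length (filterᵇ (adj G v) (allFin n))

  numEdges : ℕ
  numEdges = length (filterᵇ (λ p → (toℕ (Data.Product.proj₁ p) <ᵇ toℕ (Data.Product.proj₂ p))
                                     ∧ adj G (Data.Product.proj₁ p) (Data.Product.proj₂ p))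
                             (allPairs n))

  -- S is the vertex set of a copy of K_k in G: |S| = k and any two distinct
  -- vertices of S are adjacent.  Copies of K_k in G correspond exactly to such S.
  isKClique : ℕ → Subset n → Bool
  isKClique k S = (∣ S ∣ ≡ᵇ k) ∧
    all (λ p → not (lookup S (Data.Product.proj₁ p)) ∨ not (lookup S (Data.Product.proj₂ p))
               ∨ (toℕ (Data.Product.proj₁ p) ≡ᵇ toℕ (Data.Product.proj₂ p))
               ∨ adj G (Data.Product.proj₁ p) (Data.Product.proj₂ p))
        (allPairs n)

  copies : ℕ → List (Subset n)
  copies k = filterᵇ (isKClique k) (allSubsets n)

  copiesThrough : ℕ → Fin n → Fin n → List (Subset n)
  copiesThrough k i j = filterᵇ (λ S → lookup S i ∧ lookup S j) (copies k)

  record FractionalPacking (k : ℕ) : Set where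
    field
      ψ       : Subset n → ℚ
      nonneg  : ∀ S → 0ℚ ≤ ψ S
      le-one  : ∀ S → ψ S ≤ 1ℚ
      edgeCap : ∀ i j → adj G i j ≡ true → sumℚ (map ψ (copiesThrough k i j)) ≤ 1ℚ
  open FractionalPacking public

  packingValue : {k : ℕ} → FractionalPacking k → ℚ
  packingValue {k} P = sumℚ (map (ψ P) (copies k))

module Submission where

-- Let q be a denominator of ε and s ≥ 1.  The graph is the complete (k+1)-partite graph with
-- two large parts of size (q+1)s and k−1 small parts of size qs, so n = ((k+1)q+2)s and every
-- vertex has degree at least n − (q+1)s ≥ n(1 − 1/(k+1)) − εn.
-- Weight an edge by 2(k−2) between a large and a small part, by 2(k−3) between two small parts
-- and by 0 between the two large parts.  A copy of K_k meets k distinct parts, hence one or two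
-- large ones, and in both cases the weights of its ordered pairs add up to D = 2(k−1)²(k−2).
-- By weak LP duality a fractional K_k-packing has value at most (total weight)/D, and
-- (total weight)·C(k,2) = (e(G) − s²)·D while s² ≥ e(G)/((k+1)q+2)².

open import Data.Nat using (ℕ)

open import Defs hiding (sym)

module FinSum where

  open import Data.Bool using (Bool; true; false; _∧_; not)
  open import Data.Nat using (ℕ; zero; suc; _+_; _*_; _≤_; z≤n; s≤s)
  open import Data.Nat.Properties hiding (_≟_; suc-injective)
  open import Data.Fin using (Fin; zero; suc; _↑ˡ_; _↑ʳ_)
  open import Data.Fin.Properties using (_≟_; suc-injective)
  open import Relation.Nullary.Decidable using (does; yes; dec-true)
  open import Relation.Binary.PropositionalEquality
  open ≡-Reasoning
  open import Function using (case_of_)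
  open import Algebra.Properties.CommutativeSemigroup *-commutativeSemigroup using (x∙yz≈y∙xz)

  open import Algebra.Properties.Semiring.Sum +-*-semiring public
    using (sum; sum-syntax; sum-cong-≗; ∑-comm; ∑-distrib-+; *-distribˡ-sum; *-distribʳ-sum)

  𝟙 : Bool → ℕ
  𝟙 true  = 1
  𝟙 false = 0

  𝟙-∧ : ∀ a b → 𝟙 (a ∧ b) ≡ 𝟙 a * 𝟙 b
  𝟙-∧ true  b = sym (+-identityʳ (𝟙 b))
  𝟙-∧ false b = refl

  𝟙≤1 : ∀ a → 𝟙 a ≤ 1
  𝟙≤1 true  = s≤s z≤n
  𝟙≤1 false = z≤n

  𝟙-not : ∀ a → 𝟙 (not a) + 𝟙 a ≡ 1
  𝟙-not true  = refl
  𝟙-not false = refl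

  _==_ : ∀ {r} → Fin r → Fin r → Bool
  P == Q = does (P ≟ Q)

  ==-refl : ∀ {r} (P : Fin r) → (P == P) ≡ true
  ==-refl P = dec-true (P ≟ P) refl

  ==-sym : ∀ {r} (P Q : Fin r) → (P == Q) ≡ (Q == P)
  ==-sym zero    zero    = refl
  ==-sym zero    (suc Q) = refl
  ==-sym (suc P) zero    = refl
  ==-sym (suc P) (suc Q) = ==-sym P Q

  ==⇒≡ : ∀ {r} {P Q : Fin r} → (P == Q) ≡ true → P ≡ Q
  ==⇒≡ {P = P} {Q} eq with P ≟ Q
  ==⇒≡ refl | yes P≡Q = P≡Q

  ∑-const : ∀ n c → ∑[ i < n ] c ≡ n * c
  ∑-const zero    c = refl
  ∑-const (suc n) c = cong (c +_) (∑-const n c)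

  ∑-mono : ∀ {n} {f g : Fin n → ℕ} → (∀ i → f i ≤ g i) → sum f ≤ sum g
  ∑-mono {zero}  f≤g = z≤n
  ∑-mono {suc n} f≤g = +-mono-≤ (f≤g zero) (∑-mono (λ i → f≤g (suc i)))

  ∑-δ : ∀ {r} (P : Fin r) (g : Fin r → ℕ) → ∑[ Q < r ] (𝟙 (P == Q) * g Q) ≡ g P
  ∑-δ {suc r} zero    g = trans (cong₂ _+_ (*-identityˡ (g zero)) ∑-zero) (+-identityʳ (g zero))
    where
    ∑-zero : ∑[ Q < r ] (𝟙 (zero == suc Q) * g (suc Q)) ≡ 0
    ∑-zero = trans (∑-const r 0) (*-zeroʳ r)
  ∑-δ {suc r} (suc P) g = ∑-δ P (λ Q → g (suc Q))

  ∑-fibres : ∀ {n r} (π : Fin n → Fin r) (u : Fin n → ℕ) (g : Fin r → ℕ) →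
    ∑[ i < n ] (u i * g (π i)) ≡ ∑[ P < r ] (∑[ i < n ] (u i * 𝟙 (π i == P)) * g P)
  ∑-fibres {n} {r} π u g = begin
    ∑[ i < n ] (u i * g (π i))
      ≡⟨ sum-cong-≗ (λ i → cong (u i *_) (∑-δ (π i) g)) ⟨
    ∑[ i < n ] (u i * ∑[ P < r ] (𝟙 (π i == P) * g P))
      ≡⟨ sum-cong-≗ (λ i → *-distribˡ-sum (u i) (λ P → 𝟙 (π i == P) * g P)) ⟩
    ∑[ i < n ] ∑[ P < r ] (u i * (𝟙 (π i == P) * g P))
      ≡⟨ ∑-comm (λ i P → u i * (𝟙 (π i == P) * g P)) ⟩
    ∑[ P < r ] ∑[ i < n ] (u i * (𝟙 (π i == P) * g P))
      ≡⟨ sum-cong-≗ (λ P → trans (sum-cong-≗ (λ i → sym (*-assoc (u i) _ (g P))))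
                                  (sym (*-distribʳ-sum (g P) (λ i → u i * 𝟙 (π i == P))))) ⟩
    ∑[ P < r ] (∑[ i < n ] (u i * 𝟙 (π i == P)) * g P) ∎

  ∑-↑ : ∀ m {n} (f : Fin (m + n) → ℕ) → sum f ≡ ∑[ i < m ] f (i ↑ˡ n) + ∑[ j < n ] f (m ↑ʳ j)
  ∑-↑ zero    f = refl
  ∑-↑ (suc m) f = trans (cong (f zero +_) (∑-↑ m (λ i → f (suc i)))) (sym (+-assoc (f zero) _ _))

  ∑-𝟙-atMostOne : ∀ {n} (p : Fin n → Bool) → (∀ i j → p i ≡ true → p j ≡ true → i ≡ j) →
    ∑[ i < n ] 𝟙 (p i) ≤ 1
  ∑-𝟙-atMostOne {zero}  p unique = z≤n
  ∑-𝟙-atMostOne {suc n} p unique with p zero in p₀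
  ... | true  = s≤s (≤-reflexive (trans (sum-cong-≗ (λ i → cong 𝟙 (rest i))) (trans (∑-const n 0) (*-zeroʳ n))))
    where
    rest : ∀ i → p (suc i) ≡ false
    rest i with p (suc i) in pᵢ
    ... | true  = case unique zero (suc i) p₀ pᵢ of λ ()
    ... | false = refl
  ... | false = ∑-𝟙-atMostOne (λ i → p (suc i)) (λ i j pᵢ pⱼ → suc-injective (unique (suc i) (suc j) pᵢ pⱼ))

  ∑-offDiagonal : ∀ {r} (P : Fin r) (f : Fin r → ℕ) → ∑[ Q < r ] (𝟙 (not (P == Q)) * f Q) + f P ≡ sum f
  ∑-offDiagonal {r} P f = begin
    ∑[ Q < r ] (𝟙 (not (P == Q)) * f Q) + f P
      ≡⟨ cong (∑[ Q < r ] (𝟙 (not (P == Q)) * f Q) +_) (∑-δ P f) ⟨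
    ∑[ Q < r ] (𝟙 (not (P == Q)) * f Q) + ∑[ Q < r ] (𝟙 (P == Q) * f Q)
      ≡⟨ ∑-distrib-+ (λ Q → 𝟙 (not (P == Q)) * f Q) (λ Q → 𝟙 (P == Q) * f Q) ⟨
    ∑[ Q < r ] (𝟙 (not (P == Q)) * f Q + 𝟙 (P == Q) * f Q)
      ≡⟨ sum-cong-≗ (λ Q → trans (sym (*-distribʳ-+ (f Q) (𝟙 (not (P == Q))) _))
                                 (trans (cong (_* f Q) (𝟙-not (P == Q))) (*-identityˡ (f Q)))) ⟩
    sum f ∎

  quadForm : ∀ {r} → (Fin r → ℕ) → (Fin r → Fin r → ℕ) → ℕ
  quadForm {r} x w = ∑[ P < r ] (x P * ∑[ Q < r ] (x Q * w P Q))

  offDiagonal : ∀ {r} → (Fin r → Fin r → ℕ) → Fin r → Fin r → ℕ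
  offDiagonal w P Q = 𝟙 (not (P == Q)) * w P Q

  quadForm-offDiagonal : ∀ {r} (x : Fin r → ℕ) (w : Fin r → Fin r → ℕ) →
    quadForm x (offDiagonal w) + ∑[ P < r ] (x P * x P * w P P) ≡ quadForm x w
  quadForm-offDiagonal {r} x w = begin
    quadForm x (offDiagonal w) + ∑[ P < r ] (x P * x P * w P P)
      ≡⟨ ∑-distrib-+ (λ P → x P * ∑[ Q < r ] (x Q * offDiagonal w P Q)) (λ P → x P * x P * w P P) ⟨
    ∑[ P < r ] (x P * ∑[ Q < r ] (x Q * offDiagonal w P Q) + x P * x P * w P P)
      ≡⟨ sum-cong-≗ (λ P → trans (cong (x P * ∑[ Q < r ] (x Q * offDiagonal w P Q) +_) (*-assoc (x P) (x P) (w P P)))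
                                 (trans (sym (*-distribˡ-+ (x P) _ _)) (cong (x P *_) (row P)))) ⟩
    quadForm x w ∎
    where
    row : ∀ P → ∑[ Q < r ] (x Q * offDiagonal w P Q) + x P * w P P ≡ ∑[ Q < r ] (x Q * w P Q)
    row P = trans (cong (_+ x P * w P P) (sum-cong-≗ (λ Q → x∙yz≈y∙xz (x Q) (𝟙 (not (P == Q))) (w P Q))))
                  (∑-offDiagonal P (λ Q → x Q * w P Q))

module GraphCounting where

  open import Data.Bool using (Bool; true; false; _∧_; _∨_; not; T)
  open import Data.Bool.Properties using (∨-identityʳ)
  open import Data.Bool.ListAction using (all)
  open import Data.Nat using (ℕ; zero; suc; _+_; _*_; _≤_; _<ᵇ_; _≡ᵇ_)
  open import Data.Nat.Properties using (+-identityʳ; *-identityʳ; ≡ᵇ⇒≡; module ≤-Reasoning)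
  open import Data.Vec using ([]; _∷_; lookup)
  open import Data.Fin.Subset using (Subset; ∣_∣)
  open import Data.List.Membership.Propositional using (_∈_)
  open import Data.List.Membership.Propositional.Properties using (∈-allFin; ∈-map⁺; ∈-concatMap⁺)
  open import Data.List.Relation.Unary.Any as Any using (here; there)
  open import Data.Nat.ListAction as List using ()
  open import Data.Nat.ListAction.Properties using (sum-++)
  open import Data.Fin using (Fin; zero; suc; toℕ)
  open import Data.Fin.Properties using (toℕ-injective)
  open import Data.List using (List; []; _∷_; map; filterᵇ; length; allFin; tabulate; concatMap)
  open import Data.List.Properties using (map-++; map-∘; map-tabulate)
  open import Data.Product using (_×_; _,_; proj₁; proj₂)
  open import Relation.Binary.PropositionalEquality
  open FinSum

  length-filterᵇ : ∀ {A : Set} (p : A → Bool) xs → length (filterᵇ p xs) ≡ List.sum (map (λ x → 𝟙 (p x)) xs)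
  length-filterᵇ p []       = refl
  length-filterᵇ p (x ∷ xs) with p x
  ... | true  = cong suc (length-filterᵇ p xs)
  ... | false = length-filterᵇ p xs

  sum-tabulate : ∀ {n} (f : Fin n → ℕ) → List.sum (tabulate f) ≡ sum f
  sum-tabulate {zero}  f = refl
  sum-tabulate {suc n} f = cong (f zero +_) (sum-tabulate (λ i → f (suc i)))

  sum-map-allFin : ∀ {n} (f : Fin n → ℕ) → List.sum (map f (allFin n)) ≡ ∑[ i < n ] f i
  sum-map-allFin f = trans (cong List.sum (map-tabulate (λ i → i) f)) (sum-tabulate f)

  sum-map-concatMap : ∀ {A B : Set} (f : B → ℕ) (g : A → List B) xs →
    List.sum (map f (concatMap g xs)) ≡ List.sum (map (λ x → List.sum (map f (g x))) xs)
  sum-map-concatMap f g []       = refl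
  sum-map-concatMap f g (x ∷ xs) = begin
    List.sum (map f (g x Data.List.++ concatMap g xs))
      ≡⟨ cong List.sum (map-++ f (g x) (concatMap g xs)) ⟩
    List.sum (map f (g x) Data.List.++ map f (concatMap g xs))
      ≡⟨ sum-++ (map f (g x)) (map f (concatMap g xs)) ⟩
    List.sum (map f (g x)) + List.sum (map f (concatMap g xs))
      ≡⟨ cong (List.sum (map f (g x)) +_) (sum-map-concatMap f g xs) ⟩
    List.sum (map (λ x → List.sum (map f (g x))) (x ∷ xs)) ∎
    where open ≡-Reasoning

  sum-map-allPairs : ∀ {n} (f : Fin n × Fin n → ℕ) →
    List.sum (map f (allPairs n)) ≡ ∑[ i < n ] ∑[ j < n ] f (i , j)
  sum-map-allPairs {n} f = begin
    List.sum (map f (allPairs n))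
      ≡⟨ sum-map-concatMap f (λ i → map (i ,_) (allFin n)) (allFin n) ⟩
    List.sum (map (λ i → List.sum (map f (map (i ,_) (allFin n)))) (allFin n))
      ≡⟨ sum-map-allFin (λ i → List.sum (map f (map (i ,_) (allFin n)))) ⟩
    ∑[ i < n ] List.sum (map f (map (i ,_) (allFin n)))
      ≡⟨ sum-cong-≗ (λ i → trans (cong List.sum (sym (map-∘ (allFin n)))) (sum-map-allFin (λ j → f (i , j)))) ⟩
    ∑[ i < n ] ∑[ j < n ] f (i , j) ∎
    where open ≡-Reasoning

  𝟙-trichotomy : ∀ m n b → (m ≡ n → b ≡ false) → 𝟙 b ≡ 𝟙 ((m <ᵇ n) ∧ b) + 𝟙 ((n <ᵇ m) ∧ b)
  𝟙-trichotomy zero    zero    b m≢n = cong 𝟙 (m≢n refl)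
  𝟙-trichotomy zero    (suc n) b _   = sym (+-identityʳ (𝟙 b))
  𝟙-trichotomy (suc m) zero    b _   = refl
  𝟙-trichotomy (suc m) (suc n) b m≢n = 𝟙-trichotomy m n b (λ m≡n → m≢n (cong suc m≡n))

  all-∈ : ∀ {A : Set} (p : A → Bool) {x xs} → all p xs ≡ true → x ∈ xs → p x ≡ true
  all-∈ p {xs = y ∷ ys} all-p (here refl) with p y
  ... | true = refl
  all-∈ p {xs = y ∷ ys} all-p (there x∈ys) with p y
  ... | true = all-∈ p all-p x∈ys

  ∧-≡-true : ∀ {a b} → a ∧ b ≡ true → a ≡ true × b ≡ true
  ∧-≡-true {true} {true} _ = refl , refl

  pairCondition⇒ : ∀ {s t e a} → not s ∨ not t ∨ e ∨ a ≡ true → s ≡ true → t ≡ true → a ≡ false → e ≡ true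
  pairCondition⇒ h refl refl refl = trans (sym (∨-identityʳ _)) h

  ∈-allPairs : ∀ {n} (i j : Fin n) → (i , j) ∈ allPairs n
  ∈-allPairs {n} i j =
    ∈-concatMap⁺ (λ i′ → map (i′ ,_) (allFin n)) (Any.map (λ { refl → ∈-map⁺ (i ,_) (∈-allFin j) }) (∈-allFin i))

  ∣S∣≡∑ : ∀ {n} (S : Subset n) → ∣ S ∣ ≡ ∑[ i < n ] 𝟙 (lookup S i)
  ∣S∣≡∑ []          = refl
  ∣S∣≡∑ (true ∷ S)  = cong suc (∣S∣≡∑ S)
  ∣S∣≡∑ (false ∷ S) = ∣S∣≡∑ S

  module _ {n} (G : Graph n) where

    degree≡∑ : ∀ v → degree G v ≡ ∑[ j < n ] 𝟙 (adj G v j)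
    degree≡∑ v = trans (length-filterᵇ (adj G v) (allFin n)) (sum-map-allFin (λ j → 𝟙 (adj G v j)))

    private
      ascending : Fin n → Fin n → Bool
      ascending i j = (toℕ i <ᵇ toℕ j) ∧ adj G i j

    numEdges≡∑ : numEdges G ≡ ∑[ i < n ] ∑[ j < n ] 𝟙 (ascending i j)
    numEdges≡∑ = trans (length-filterᵇ _ (allPairs n)) (sum-map-allPairs (λ p → 𝟙 (ascending (proj₁ p) (proj₂ p))))

    twice-numEdges : 2 * numEdges G ≡ ∑[ i < n ] ∑[ j < n ] 𝟙 (adj G i j)
    twice-numEdges = begin
      2 * numEdges G
        ≡⟨ cong (2 *_) numEdges≡∑ ⟩
      2 * ∑[ i < n ] ∑[ j < n ] 𝟙 (ascending i j)
        ≡⟨ cong (∑[ i < n ] ∑[ j < n ] 𝟙 (ascending i j) +_) (+-identityʳ _) ⟩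
      ∑[ i < n ] ∑[ j < n ] 𝟙 (ascending i j) + ∑[ j < n ] ∑[ i < n ] 𝟙 (ascending j i)
        ≡⟨ cong (∑[ i < n ] ∑[ j < n ] 𝟙 (ascending i j) +_) (∑-comm (λ i j → 𝟙 (ascending j i))) ⟨
      ∑[ i < n ] ∑[ j < n ] 𝟙 (ascending i j) + ∑[ i < n ] ∑[ j < n ] 𝟙 (ascending j i)
        ≡⟨ ∑-distrib-+ (λ i → ∑[ j < n ] 𝟙 (ascending i j)) (λ i → ∑[ j < n ] 𝟙 (ascending j i)) ⟨
      ∑[ i < n ] (∑[ j < n ] 𝟙 (ascending i j) + ∑[ j < n ] 𝟙 (ascending j i))
        ≡⟨ sum-cong-≗ (λ i → sym (∑-distrib-+ (λ j → 𝟙 (ascending i j)) (λ j → 𝟙 (ascending j i)))) ⟩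
      ∑[ i < n ] ∑[ j < n ] (𝟙 (ascending i j) + 𝟙 (ascending j i))
        ≡⟨ sum-cong-≗ (λ i → sum-cong-≗ (λ j → sym (split i j))) ⟩
      ∑[ i < n ] ∑[ j < n ] 𝟙 (adj G i j) ∎
      where
      open ≡-Reasoning
      split : ∀ i j → 𝟙 (adj G i j) ≡ 𝟙 (ascending i j) + 𝟙 (ascending j i)
      split i j = trans (𝟙-trichotomy (toℕ i) (toℕ j) (adj G i j)
                                       (λ eq → trans (cong (adj G i) (sym (toℕ-injective eq))) (irrefl G i)))
                        (cong (λ b → 𝟙 (ascending i j) + 𝟙 ((toℕ j <ᵇ toℕ i) ∧ b)) (Graph.sym G i j))

    numEdges≤n*n : numEdges G ≤ n * n
    numEdges≤n*n = begin
      numEdges G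
        ≡⟨ numEdges≡∑ ⟩
      ∑[ i < n ] ∑[ j < n ] 𝟙 (ascending i j)
        ≤⟨ ∑-mono (λ i → ∑-mono (λ j → 𝟙≤1 (ascending i j))) ⟩
      ∑[ i < n ] ∑[ j < n ] 1
        ≡⟨ trans (sum-cong-≗ {n = n} (λ i → trans (∑-const n 1) (*-identityʳ n))) (∑-const n n) ⟩
      n * n ∎
      where open ≤-Reasoning

    module _ {k} (S : Subset n) (clique : isKClique G k S ≡ true) where

      isKClique⇒∣S∣≡k : ∣ S ∣ ≡ k
      isKClique⇒∣S∣≡k = ≡ᵇ⇒≡ ∣ S ∣ k (subst T (sym (proj₁ (∧-≡-true clique))) _)

      isKClique⇒nonadjacent⇒≡ : ∀ {i j} → lookup S i ≡ true → lookup S j ≡ true → adj G i j ≡ false → i ≡ j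
      isKClique⇒nonadjacent⇒≡ {i} {j} Sᵢ Sⱼ ¬adj =
        toℕ-injective (≡ᵇ⇒≡ (toℕ i) (toℕ j) (subst T (sym toℕ≡ᵇ) _))
        where
        toℕ≡ᵇ : (toℕ i ≡ᵇ toℕ j) ≡ true
        toℕ≡ᵇ = pairCondition⇒ (all-∈ _ (proj₂ (∧-≡-true clique)) (∈-allPairs i j)) Sᵢ Sⱼ ¬adj

    weightWithin : (Fin n → Fin n → ℕ) → Subset n → ℕ
    weightWithin W S = ∑[ i < n ] ∑[ j < n ] (𝟙 (adj G i j ∧ (lookup S i ∧ lookup S j)) * W i j)

    totalWeight : (Fin n → Fin n → ℕ) → ℕ
    totalWeight W = ∑[ i < n ] ∑[ j < n ] (𝟙 (adj G i j) * W i j)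

module CompleteMultipartite where

  open import Data.Bool using (true; false; _∧_; not)
  open import Data.Nat using (ℕ; zero; suc; _+_; _*_; _≤_)
  open import Data.Nat.Properties using (*-comm; *-identityʳ)
  open import Data.Fin using (Fin; zero; suc; splitAt; _↑ˡ_; _↑ʳ_)
  open import Data.Fin.Properties using (splitAt-↑ˡ; splitAt-↑ʳ)
  open import Data.Fin.Subset using (Subset; ∣_∣)
  open import Data.Vec using (lookup)
  open import Data.Sum using ([_,_]′)
  open import Data.Product using (_,_)
  open import Relation.Binary.PropositionalEquality
  open import Data.Nat.Tactic.RingSolver using (solve-∀)
  open ≡-Reasoning
  open FinSum
  open GraphCounting

  part : ∀ {r} (sizes : Fin r → ℕ) → Fin (sum sizes) → Fin r
  part {suc r} sizes i = [ (λ _ → zero) , (λ j → suc (part (λ P → sizes (suc P)) j)) ]′ (splitAt (sizes zero) i)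

  ∑-part : ∀ {r} (sizes : Fin r → ℕ) (g : Fin r → ℕ) →
    ∑[ i < sum sizes ] g (part sizes i) ≡ ∑[ P < r ] (sizes P * g P)
  ∑-part {zero}  sizes g = refl
  ∑-part {suc r} sizes g = begin
    ∑[ i < sum sizes ] g (part sizes i)
      ≡⟨ ∑-↑ (sizes zero) (λ i → g (part sizes i)) ⟩
    ∑[ i < sizes zero ] g (part sizes (i ↑ˡ rest)) + ∑[ j < rest ] g (part sizes (sizes zero ↑ʳ j))
      ≡⟨ cong₂ _+_ (trans (sum-cong-≗ (λ i → cong (λ x → g ([ _ , _ ]′ x)) (splitAt-↑ˡ (sizes zero) i rest)))
                          (∑-const (sizes zero) (g zero)))
                   (trans (sum-cong-≗ (λ j → cong (λ x → g ([ _ , _ ]′ x)) (splitAt-↑ʳ (sizes zero) rest j)))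
                          (∑-part (λ P → sizes (suc P)) (λ P → g (suc P)))) ⟩
    ∑[ P < suc r ] (sizes P * g P) ∎
    where
    rest : ℕ
    rest = ∑[ P < r ] sizes (suc P)

  ∑∑-part : ∀ {r} (sizes : Fin r → ℕ) (g : Fin r → Fin r → ℕ) →
    ∑[ i < sum sizes ] ∑[ j < sum sizes ] g (part sizes i) (part sizes j) ≡ quadForm sizes g
  ∑∑-part {r} sizes g = trans (sum-cong-≗ (λ i → ∑-part sizes (g (part sizes i))))
                              (∑-part sizes (λ P → ∑[ Q < r ] (sizes Q * g P Q)))

  module _ {r} (sizes : Fin r → ℕ) where

    private
      n : ℕ
      n = sum sizes

      π : Fin n → Fin r
      π = part sizes

    completeMultipartite : Graph n
    completeMultipartite = record
      { adj    = λ i j → not (π i == π j)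
      ; sym    = λ i j → cong not (==-sym (π i) (π j))
      ; irrefl = λ i → cong not (==-refl (π i))
      }

    degree-completeMultipartite : ∀ v → degree completeMultipartite v + sizes (π v) ≡ n
    degree-completeMultipartite v = begin
      degree completeMultipartite v + sizes (π v)
        ≡⟨ cong (_+ sizes (π v)) (trans (degree≡∑ completeMultipartite v) (∑-part sizes (λ Q → 𝟙 (not (π v == Q))))) ⟩
      ∑[ Q < r ] (sizes Q * 𝟙 (not (π v == Q))) + sizes (π v)
        ≡⟨ cong (_+ sizes (π v)) (sum-cong-≗ (λ Q → *-comm (sizes Q) _)) ⟩
      ∑[ Q < r ] (𝟙 (not (π v == Q)) * sizes Q) + sizes (π v)
        ≡⟨ ∑-offDiagonal (π v) sizes ⟩
      n ∎

    profile : Subset n → Fin r → ℕ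
    profile S P = ∑[ i < n ] (𝟙 (lookup S i) * 𝟙 (π i == P))

    weightWithin-completeMultipartite : ∀ (w : Fin r → Fin r → ℕ) S →
      weightWithin completeMultipartite (λ i j → w (π i) (π j)) S ≡ quadForm (profile S) (offDiagonal w)
    weightWithin-completeMultipartite w S = begin
      weightWithin completeMultipartite (λ i j → w (π i) (π j)) S
        ≡⟨ sum-cong-≗ (λ i → sum-cong-≗ (λ j → 𝟙-∧-∧ (not (π i == π j)) (lookup S i) (lookup S j) (w (π i) (π j)))) ⟩
      ∑[ i < n ] ∑[ j < n ] (𝟙 (lookup S i) * (𝟙 (lookup S j) * offDiagonal w (π i) (π j)))
        ≡⟨ sum-cong-≗ (λ i → *-distribˡ-sum (𝟙 (lookup S i)) (λ j → 𝟙 (lookup S j) * offDiagonal w (π i) (π j))) ⟨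
      ∑[ i < n ] (𝟙 (lookup S i) * ∑[ j < n ] (𝟙 (lookup S j) * offDiagonal w (π i) (π j)))
        ≡⟨ sum-cong-≗ (λ i → cong (𝟙 (lookup S i) *_) (∑-fibres π (λ j → 𝟙 (lookup S j)) (offDiagonal w (π i)))) ⟩
      ∑[ i < n ] (𝟙 (lookup S i) * ∑[ Q < r ] (profile S Q * offDiagonal w (π i) Q))
        ≡⟨ ∑-fibres π (λ i → 𝟙 (lookup S i)) (λ P → ∑[ Q < r ] (profile S Q * offDiagonal w P Q)) ⟩
      quadForm (profile S) (offDiagonal w) ∎
      where
      𝟙-∧-∧ : ∀ a s t w → 𝟙 (a ∧ (s ∧ t)) * w ≡ 𝟙 s * (𝟙 t * (𝟙 a * w))
      𝟙-∧-∧ a s t w = trans (cong (_* w) (trans (𝟙-∧ a (s ∧ t)) (cong (𝟙 a *_) (𝟙-∧ s t))))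
                            (reorder (𝟙 a) (𝟙 s) (𝟙 t) w)
        where
        reorder : ∀ a s t w → a * (s * t) * w ≡ s * (t * (a * w))
        reorder = solve-∀

    ∑-profile : ∀ S → ∑[ P < r ] profile S P ≡ ∣ S ∣
    ∑-profile S = begin
      ∑[ P < r ] profile S P
        ≡⟨ sum-cong-≗ (λ P → *-identityʳ (profile S P)) ⟨
      ∑[ P < r ] (profile S P * 1)
        ≡⟨ ∑-fibres π (λ i → 𝟙 (lookup S i)) (λ _ → 1) ⟨
      ∑[ i < n ] (𝟙 (lookup S i) * 1)
        ≡⟨ sum-cong-≗ (λ i → *-identityʳ (𝟙 (lookup S i))) ⟩
      ∑[ i < n ] 𝟙 (lookup S i)
        ≡⟨ ∣S∣≡∑ S ⟨
      ∣ S ∣ ∎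

    profile≤1 : ∀ {k} S → isKClique completeMultipartite k S ≡ true → ∀ P → profile S P ≤ 1
    profile≤1 S clique P = subst (_≤ 1) (sum-cong-≗ (λ i → 𝟙-∧ (lookup S i) (π i == P)))
                                       (∑-𝟙-atMostOne (λ i → lookup S i ∧ (π i == P)) unique)
      where
      unique : ∀ i j → (lookup S i ∧ (π i == P)) ≡ true → (lookup S j ∧ (π j == P)) ≡ true → i ≡ j
      unique i j Sᵢ∧πᵢ≡P Sⱼ∧πⱼ≡P with ∧-≡-true Sᵢ∧πᵢ≡P | ∧-≡-true Sⱼ∧πⱼ≡P
      ... | Sᵢ , πᵢ≡P | Sⱼ , πⱼ≡P = isKClique⇒nonadjacent⇒≡ completeMultipartite S clique Sᵢ Sⱼ nonadjacent
        where
        nonadjacent : not (π i == π j) ≡ false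
        nonadjacent = cong not (subst (λ Q → (π i == Q) ≡ true) (trans (==⇒≡ πᵢ≡P) (sym (==⇒≡ πⱼ≡P))) (==-refl (π i)))

    totalWeight-completeMultipartite : ∀ (w : Fin r → Fin r → ℕ) →
      totalWeight completeMultipartite (λ i j → w (π i) (π j)) ≡ quadForm sizes (offDiagonal w)
    totalWeight-completeMultipartite w = ∑∑-part sizes (offDiagonal w)

    twice-numEdges-completeMultipartite : 2 * numEdges completeMultipartite ≡ quadForm sizes (offDiagonal (λ _ _ → 1))
    twice-numEdges-completeMultipartite =
      trans (twice-numEdges completeMultipartite)
            (trans (sum-cong-≗ (λ i → sum-cong-≗ (λ j → sym (*-identityʳ (𝟙 (adj completeMultipartite i j))))))
                   (totalWeight-completeMultipartite (λ _ _ → 1)))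

module NatToRational where

  open import Data.Nat as ℕ using (ℕ)
  open import Data.Nat.Coprimality using (sym; 1-coprimeTo)
  open import Data.Integer as ℤ using (+_)
  import Data.Integer.Properties as ℤ
  open import Data.Rational using (mkℚ; _+_; _*_; _≤_; 0ℚ; toℚᵘ)
  open import Data.Rational.Properties using (normalize-coprime; toℚᵘ-injective; toℚᵘ-cancel-≤; toℚᵘ-homo-+; toℚᵘ-homo-*)
  import Data.Rational.Unnormalised as ℚᵘ
  import Data.Rational.Unnormalised.Properties as ℚᵘ
  open import Relation.Binary.PropositionalEquality using (_≡_; cong; cong₂; trans) renaming (sym to ≡-sym)

  ℕ→ℚ≡mkℚ : ∀ m → ℕ→ℚ m ≡ mkℚ (+ m) 0 (sym (1-coprimeTo m))
  ℕ→ℚ≡mkℚ m = normalize-coprime (sym (1-coprimeTo m))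

  private
    toℚᵘ-ℕ→ℚ : ∀ m → toℚᵘ (ℕ→ℚ m) ℚᵘ.≃ ℚᵘ.mkℚᵘ (+ m) 0
    toℚᵘ-ℕ→ℚ m = ℚᵘ.≃-reflexive (cong toℚᵘ (ℕ→ℚ≡mkℚ m))

  ℕ→ℚ-+ : ∀ m n → ℕ→ℚ (m ℕ.+ n) ≡ ℕ→ℚ m + ℕ→ℚ n
  ℕ→ℚ-+ m n = toℚᵘ-injective (begin
    toℚᵘ (ℕ→ℚ (m ℕ.+ n))                      ≈⟨ toℚᵘ-ℕ→ℚ (m ℕ.+ n) ⟩
    ℚᵘ.mkℚᵘ (+ (m ℕ.+ n)) 0                    ≈⟨ ℚᵘ.*≡* numerators ⟩
    ℚᵘ.mkℚᵘ (+ m) 0 ℚᵘ.+ ℚᵘ.mkℚᵘ (+ n) 0       ≈⟨ ℚᵘ.+-cong (toℚᵘ-ℕ→ℚ m) (toℚᵘ-ℕ→ℚ n) ⟨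
    toℚᵘ (ℕ→ℚ m) ℚᵘ.+ toℚᵘ (ℕ→ℚ n)            ≈⟨ toℚᵘ-homo-+ (ℕ→ℚ m) (ℕ→ℚ n) ⟨
    toℚᵘ (ℕ→ℚ m + ℕ→ℚ n)                      ∎)
    where
    open ℚᵘ.≃-Reasoning
    numerators : + (m ℕ.+ n) ℤ.* + 1 ≡ (+ m ℤ.* + 1 ℤ.+ + n ℤ.* + 1) ℤ.* + 1
    numerators = trans (ℤ.*-identityʳ _) (trans (ℤ.pos-+ m n)
      (≡-sym (trans (ℤ.*-identityʳ _) (cong₂ ℤ._+_ (ℤ.*-identityʳ (+ m)) (ℤ.*-identityʳ (+ n))))))

  ℕ→ℚ-* : ∀ m n → ℕ→ℚ (m ℕ.* n) ≡ ℕ→ℚ m * ℕ→ℚ n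
  ℕ→ℚ-* m n = toℚᵘ-injective (begin
    toℚᵘ (ℕ→ℚ (m ℕ.* n))                      ≈⟨ toℚᵘ-ℕ→ℚ (m ℕ.* n) ⟩
    ℚᵘ.mkℚᵘ (+ (m ℕ.* n)) 0                    ≈⟨ ℚᵘ.*≡* (cong (ℤ._* + 1) (ℤ.pos-* m n)) ⟩
    ℚᵘ.mkℚᵘ (+ m) 0 ℚᵘ.* ℚᵘ.mkℚᵘ (+ n) 0       ≈⟨ ℚᵘ.*-cong (toℚᵘ-ℕ→ℚ m) (toℚᵘ-ℕ→ℚ n) ⟨
    toℚᵘ (ℕ→ℚ m) ℚᵘ.* toℚᵘ (ℕ→ℚ n)            ≈⟨ toℚᵘ-homo-* (ℕ→ℚ m) (ℕ→ℚ n) ⟨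
    toℚᵘ (ℕ→ℚ m * ℕ→ℚ n)                      ∎)
    where open ℚᵘ.≃-Reasoning

  ℕ→ℚ-mono-≤ : ∀ {m n} → m ℕ.≤ n → ℕ→ℚ m ≤ ℕ→ℚ n
  ℕ→ℚ-mono-≤ {m} {n} m≤n = toℚᵘ-cancel-≤
    (ℚᵘ.≤-respʳ-≃ (ℚᵘ.≃-sym (toℚᵘ-ℕ→ℚ n)) (ℚᵘ.≤-respˡ-≃ (ℚᵘ.≃-sym (toℚᵘ-ℕ→ℚ m))
      (ℚᵘ.*≤* (ℤ.*-monoʳ-≤-nonNeg (+ 1) (ℤ.+≤+ m≤n)))))

  0≤ℕ→ℚ : ∀ m → 0ℚ ≤ ℕ→ℚ m
  0≤ℕ→ℚ m = ℕ→ℚ-mono-≤ {0} {m} ℕ.z≤n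

module RationalListSum where

  open import Data.Bool using (Bool; true; false)
  open import Data.Nat as ℕ using (ℕ)
  open import Data.Nat.ListAction as List using ()
  open import Data.List using (List; []; _∷_; map; filterᵇ)
  open import Data.Rational using (ℚ; _+_; _*_; _≤_; 0ℚ)
  open import Data.Rational.Properties
  open import Algebra.Bundles using (CommutativeMonoid)
  open import Algebra.Properties.CommutativeSemigroup (CommutativeMonoid.commutativeSemigroup +-0-commutativeMonoid)
    using (interchange)
  open import Relation.Binary.PropositionalEquality
  open FinSum using (𝟙)
  open NatToRational

  module _ {A : Set} where

    sumℚ-cong : ∀ {f g : A → ℚ} xs → (∀ x → f x ≡ g x) → sumℚ (map f xs) ≡ sumℚ (map g xs)
    sumℚ-cong []       f≡g = refl
    sumℚ-cong (x ∷ xs) f≡g = cong₂ _+_ (f≡g x) (sumℚ-cong xs f≡g)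

    sumℚ-mono-filterᵇ : ∀ (p : A → Bool) {f g : A → ℚ} xs → (∀ x → p x ≡ true → f x ≤ g x) →
      sumℚ (map f (filterᵇ p xs)) ≤ sumℚ (map g (filterᵇ p xs))
    sumℚ-mono-filterᵇ p []       f≤g = ≤-refl
    sumℚ-mono-filterᵇ p (x ∷ xs) f≤g with p x in pₓ
    ... | true  = +-mono-≤ (f≤g x pₓ) (sumℚ-mono-filterᵇ p xs f≤g)
    ... | false = sumℚ-mono-filterᵇ p xs f≤g

    sumℚ-mono : ∀ {f g : A → ℚ} xs → (∀ x → f x ≤ g x) → sumℚ (map f xs) ≤ sumℚ (map g xs)
    sumℚ-mono []       f≤g = ≤-refl
    sumℚ-mono (x ∷ xs) f≤g = +-mono-≤ (f≤g x) (sumℚ-mono xs f≤g)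

    sumℚ-zero : ∀ xs → sumℚ (map (λ (_ : A) → 0ℚ) xs) ≡ 0ℚ
    sumℚ-zero []       = refl
    sumℚ-zero (x ∷ xs) = trans (+-identityˡ _) (sumℚ-zero xs)

    sumℚ-+ : ∀ (f g : A → ℚ) xs → sumℚ (map (λ x → f x + g x) xs) ≡ sumℚ (map f xs) + sumℚ (map g xs)
    sumℚ-+ f g []       = refl
    sumℚ-+ f g (x ∷ xs) = trans (cong (f x + g x +_) (sumℚ-+ f g xs)) (interchange (f x) (g x) _ _)

    *-distribˡ-sumℚ : ∀ c (f : A → ℚ) xs → c * sumℚ (map f xs) ≡ sumℚ (map (λ x → c * f x) xs)
    *-distribˡ-sumℚ c f []       = *-zeroʳ c
    *-distribˡ-sumℚ c f (x ∷ xs) = trans (*-distribˡ-+ c (f x) _) (cong (c * f x +_) (*-distribˡ-sumℚ c f xs))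

    *-distribʳ-sumℚ : ∀ c (f : A → ℚ) xs → sumℚ (map f xs) * c ≡ sumℚ (map (λ x → f x * c) xs)
    *-distribʳ-sumℚ c f []       = *-zeroˡ c
    *-distribʳ-sumℚ c f (x ∷ xs) = trans (*-distribʳ-+ c (f x) _) (cong (f x * c +_) (*-distribʳ-sumℚ c f xs))

    sumℚ-filterᵇ : ∀ (p : A → Bool) (f : A → ℚ) xs →
      sumℚ (map f (filterᵇ p xs)) ≡ sumℚ (map (λ x → ℕ→ℚ (𝟙 (p x)) * f x) xs)
    sumℚ-filterᵇ p f []       = refl
    sumℚ-filterᵇ p f (x ∷ xs) with p x
    ... | true  = cong₂ _+_ (sym (*-identityˡ (f x))) (sumℚ-filterᵇ p f xs)
    ... | false = trans (sumℚ-filterᵇ p f xs) (sym (trans (cong (_+ _) (*-zeroˡ (f x))) (+-identityˡ _)))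

    ℕ→ℚ-sum : ∀ (h : A → ℕ) xs → ℕ→ℚ (List.sum (map h xs)) ≡ sumℚ (map (λ x → ℕ→ℚ (h x)) xs)
    ℕ→ℚ-sum h []       = refl
    ℕ→ℚ-sum h (x ∷ xs) = trans (ℕ→ℚ-+ (h x) _) (cong (ℕ→ℚ (h x) +_) (ℕ→ℚ-sum h xs))

  sumℚ-swap : ∀ {A B : Set} (f : A → B → ℚ) xs ys →
    sumℚ (map (λ x → sumℚ (map (f x) ys)) xs) ≡ sumℚ (map (λ y → sumℚ (map (λ x → f x y) xs)) ys)
  sumℚ-swap f []       ys = sym (sumℚ-zero ys)
  sumℚ-swap f (x ∷ xs) ys = trans (cong (sumℚ (map (f x) ys) +_) (sumℚ-swap f xs ys))
                                  (sym (sumℚ-+ (f x) (λ y → sumℚ (map (λ x → f x y) xs)) ys))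

module Duality where

  open import Data.Bool using (Bool; true; false; _∧_)
  open import Data.Nat as ℕ using (ℕ)
  import Data.Nat.Properties as ℕ
  open import Data.Nat.ListAction as List using ()
  open import Data.Fin using (Fin)
  open import Data.Fin.Subset using (Subset)
  open import Data.Vec using (lookup)
  open import Data.List using (List; map)
  open import Data.Product using (_×_; _,_)
  open import Data.Rational using (_*_; _≤_; 1ℚ; nonNegative)
  open import Data.Rational.Properties
  open import Relation.Binary.PropositionalEquality
  open FinSum using (𝟙)
  open GraphCounting using (weightWithin; totalWeight; sum-map-allPairs)
  open NatToRational
  open RationalListSum

  module _ {n} (G : Graph n) (k : ℕ) (W : Fin n → Fin n → ℕ) (D : ℕ)
           (heavy : ∀ S → isKClique G k S ≡ true → D ℕ.≤ weightWithin G W S) where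

    private
      pairWeightIn : Subset n → Fin n × Fin n → ℕ
      pairWeightIn S (i , j) = 𝟙 (adj G i j ∧ (lookup S i ∧ lookup S j)) ℕ.* W i j

      pairWeight : Fin n × Fin n → ℕ
      pairWeight (i , j) = 𝟙 (adj G i j) ℕ.* W i j

    load≤pairWeight : ∀ (P : FractionalPacking G k) i j →
      sumℚ (map (λ S → ψ P S * ℕ→ℚ (𝟙 (adj G i j ∧ (lookup S i ∧ lookup S j)) ℕ.* W i j)) (copies G k))
        ≤ ℕ→ℚ (𝟙 (adj G i j) ℕ.* W i j)
    load≤pairWeight P i j with adj G i j in adjᵢⱼ
    ... | false = ≤-reflexive (trans (sumℚ-cong (copies G k) (λ S → *-zeroʳ (ψ P S))) (sumℚ-zero (copies G k)))
    ... | true  = begin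
      sumℚ (map (λ S → ψ P S * ℕ→ℚ (𝟙 (Sᵢⱼ S) ℕ.* W i j)) (copies G k))
        ≡⟨ sumℚ-cong (copies G k) (λ S → trans (cong (ψ P S *_) (ℕ→ℚ-* (𝟙 (Sᵢⱼ S)) (W i j)))
                                              (reorder (ψ P S) (ℕ→ℚ (𝟙 (Sᵢⱼ S))) (ℕ→ℚ (W i j)))) ⟩
      sumℚ (map (λ S → ℕ→ℚ (𝟙 (Sᵢⱼ S)) * ψ P S * ℕ→ℚ (W i j)) (copies G k))
        ≡⟨ *-distribʳ-sumℚ (ℕ→ℚ (W i j)) (λ S → ℕ→ℚ (𝟙 (Sᵢⱼ S)) * ψ P S) (copies G k) ⟨
      sumℚ (map (λ S → ℕ→ℚ (𝟙 (Sᵢⱼ S)) * ψ P S) (copies G k)) * ℕ→ℚ (W i j)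
        ≡⟨ cong (_* ℕ→ℚ (W i j)) (sumℚ-filterᵇ Sᵢⱼ (ψ P) (copies G k)) ⟨
      sumℚ (map (ψ P) (copiesThrough G k i j)) * ℕ→ℚ (W i j)
        ≤⟨ *-monoʳ-≤-nonNeg (ℕ→ℚ (W i j)) {{nonNegative (0≤ℕ→ℚ (W i j))}} (edgeCap P i j adjᵢⱼ) ⟩
      1ℚ * ℕ→ℚ (W i j)
        ≡⟨ trans (*-identityˡ (ℕ→ℚ (W i j))) (cong ℕ→ℚ (sym (ℕ.+-identityʳ (W i j)))) ⟩
      ℕ→ℚ (1 ℕ.* W i j) ∎
      where
      open ≤-Reasoning
      Sᵢⱼ : Subset n → Bool
      Sᵢⱼ S = lookup S i ∧ lookup S j
      reorder : ∀ a b c → a * (b * c) ≡ b * a * c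
      reorder a b c = trans (sym (*-assoc a b c)) (cong (_* c) (*-comm a b))

    packingValue*D≤totalWeight : (P : FractionalPacking G k) → packingValue G P * ℕ→ℚ D ≤ ℕ→ℚ (totalWeight G W)
    packingValue*D≤totalWeight P = begin
      packingValue G P * ℕ→ℚ D
        ≡⟨ *-distribʳ-sumℚ (ℕ→ℚ D) (ψ P) (copies G k) ⟩
      sumℚ (map (λ S → ψ P S * ℕ→ℚ D) (copies G k))
        ≤⟨ sumℚ-mono-filterᵇ (isKClique G k) (allSubsets n) (λ S clique →
             *-monoˡ-≤-nonNeg (ψ P S) {{nonNegative (nonneg P S)}} (ℕ→ℚ-mono-≤ (heavy S clique))) ⟩
      sumℚ (map (λ S → ψ P S * ℕ→ℚ (weightWithin G W S)) (copies G k))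
        ≡⟨ sumℚ-cong (copies G k) (λ S → cong (ψ P S *_) (trans (cong ℕ→ℚ (sym (sum-map-allPairs (pairWeightIn S))))
             (ℕ→ℚ-sum (pairWeightIn S) (allPairs n)))) ⟩
      sumℚ (map (λ S → ψ P S * sumℚ (map (λ p → ℕ→ℚ (pairWeightIn S p)) (allPairs n))) (copies G k))
        ≡⟨ sumℚ-cong (copies G k) (λ S → *-distribˡ-sumℚ (ψ P S) (λ p → ℕ→ℚ (pairWeightIn S p)) (allPairs n)) ⟩
      sumℚ (map (λ S → sumℚ (map (λ p → ψ P S * ℕ→ℚ (pairWeightIn S p)) (allPairs n))) (copies G k))
        ≡⟨ sumℚ-swap (λ S p → ψ P S * ℕ→ℚ (pairWeightIn S p)) (copies G k) (allPairs n) ⟩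
      sumℚ (map (λ p → sumℚ (map (λ S → ψ P S * ℕ→ℚ (pairWeightIn S p)) (copies G k))) (allPairs n))
        ≤⟨ sumℚ-mono (allPairs n) (λ (i , j) → load≤pairWeight P i j) ⟩
      sumℚ (map (λ p → ℕ→ℚ (pairWeight p)) (allPairs n))
        ≡⟨ ℕ→ℚ-sum pairWeight (allPairs n) ⟨
      ℕ→ℚ (List.sum (map pairWeight (allPairs n)))
        ≡⟨ cong ℕ→ℚ (sum-map-allPairs pairWeight) ⟩
      ℕ→ℚ (totalWeight G W) ∎
      where open ≤-Reasoning

module TwoClasses (K : ℕ) where

  open import Data.Bool using (Bool; true; false)
  open import Data.Nat using (ℕ; zero; suc; _+_; _*_)
  open import Data.Fin using (Fin; zero; suc)
  open import Relation.Binary.PropositionalEquality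
  open import Data.Nat.Tactic.RingSolver using (solve-∀)
  open FinSum

  isLarge : Fin (suc (suc K)) → Bool
  isLarge zero          = true
  isLarge (suc zero)    = true
  isLarge (suc (suc _)) = false

  largeMass smallMass : (Fin (suc (suc K)) → ℕ) → ℕ
  largeMass x = x zero + x (suc zero)
  smallMass x = ∑[ i < K ] x (suc (suc i))

  ∑-byClass : ∀ x (h : Bool → ℕ) →
    ∑[ P < suc (suc K) ] (x P * h (isLarge P)) ≡ largeMass x * h true + smallMass x * h false
  ∑-byClass x h = trans (cong (λ t → x zero * h true + (x (suc zero) * h true + t))
                              (sym (*-distribʳ-sum (h false) (λ i → x (suc (suc i))))))
                        (regroup (x zero) (x (suc zero)) (h true) (h false) (smallMass x))
    where
    regroup : ∀ x₀ x₁ t f m → x₀ * t + (x₁ * t + m * f) ≡ (x₀ + x₁) * t + m * f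
    regroup = solve-∀

  quadForm-byClass : ∀ x (ω : Bool → Bool → ℕ) →
    quadForm x (λ P Q → ω (isLarge P) (isLarge Q))
      ≡ largeMass x * (largeMass x * ω true true  + smallMass x * ω true false)
      + smallMass x * (largeMass x * ω false true + smallMass x * ω false false)
  quadForm-byClass x ω =
    trans (sum-cong-≗ (λ P → cong (x P *_) (∑-byClass x (ω (isLarge P)))))
          (∑-byClass x (λ t → largeMass x * ω t true + smallMass x * ω t false))

module TwoLargeParts (j a b : ℕ) where

  open import Data.Bool using (Bool; true; false)
  open import Data.Nat using (ℕ; zero; suc; _+_; _*_; _≤_; z≤n; s≤s)
  open import Data.Nat.Properties
  open import Data.Fin using (Fin; zero; suc)
  open import Data.Fin.Subset using (∣_∣)
  open import Relation.Binary.PropositionalEquality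
  open import Relation.Nullary using (contradiction)
  open import Data.Nat.Tactic.RingSolver using (solve-∀)
  open ≡-Reasoning
  open FinSum
  open GraphCounting
  open CompleteMultipartite
  open TwoClasses (suc (suc j)) public

  k K : ℕ
  k = suc (suc (suc j))
  K = suc (suc j)

  sizes : Fin (suc (suc K)) → ℕ
  sizes zero          = a
  sizes (suc zero)    = a
  sizes (suc (suc _)) = b

  n : ℕ
  n = sum sizes

  G : Graph n
  G = completeMultipartite sizes

  classWeight : Bool → Bool → ℕ
  classWeight true  true  = 0
  classWeight true  false = 2 * suc j
  classWeight false true  = 2 * suc j
  classWeight false false = 2 * j

  partWeight : Fin (suc (suc K)) → Fin (suc (suc K)) → ℕ
  partWeight P Q = classWeight (isLarge P) (isLarge Q)

  W : Fin n → Fin n → ℕ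
  W i i′ = partWeight (part sizes i) (part sizes i′)

  D : ℕ
  D = 2 * (K * K * suc j)

  x≤1⇒x*x≡x : ∀ {x} → x ≤ 1 → x * x ≡ x
  x≤1⇒x*x≡x z≤n       = refl
  x≤1⇒x*x≡x (s≤s z≤n) = refl

  -- α and β count the vertices of a K_k in the large and in the small parts.
  D≤cliqueWeight : ∀ α β Y → α ≤ 2 → β ≤ K → α + β ≡ k →
    Y + (α * 0 + β * (2 * j)) ≡ α * (α * 0 + β * (2 * suc j)) + β * (α * (2 * suc j) + β * (2 * j)) → D ≤ Y
  D≤cliqueWeight zero                β Y _ β≤K refl _ = contradiction β≤K (n≮n K)
  D≤cliqueWeight (suc zero)          β Y _ _   refl eq = ≤-reflexive (+-cancelʳ-≡ _ D Y (trans (identity j) (sym eq)))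
    where
    identity : ∀ j → 2 * (suc (suc j) * suc (suc j) * suc j) + (1 * 0 + suc (suc j) * (2 * j))
                   ≡ 1 * (1 * 0 + suc (suc j) * (2 * suc j)) + suc (suc j) * (1 * (2 * suc j) + suc (suc j) * (2 * j))
    identity = solve-∀
  D≤cliqueWeight (suc (suc zero))    β Y _ _   refl eq = ≤-reflexive (+-cancelʳ-≡ _ D Y (trans (identity j) (sym eq)))
    where
    identity : ∀ j → 2 * (suc (suc j) * suc (suc j) * suc j) + (2 * 0 + suc j * (2 * j))
                   ≡ 2 * (2 * 0 + suc j * (2 * suc j)) + suc j * (2 * (2 * suc j) + suc j * (2 * j))
    identity = solve-∀
  D≤cliqueWeight (suc (suc (suc α))) β Y (s≤s (s≤s ())) _ _ _

  heavyCliques : ∀ S → isKClique G k S ≡ true → D ≤ weightWithin G W S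
  heavyCliques S clique = D≤cliqueWeight α β (weightWithin G W S) α≤2 β≤K α+β≡k weight-identity
    where
    c : Fin (suc (suc K)) → ℕ
    c = profile sizes S

    c≤1 : ∀ P → c P ≤ 1
    c≤1 = profile≤1 sizes S clique

    α β : ℕ
    α = largeMass c
    β = smallMass c

    α≤2 : α ≤ 2
    α≤2 = +-mono-≤ (c≤1 zero) (c≤1 (suc zero))

    β≤K : β ≤ K
    β≤K = ≤-trans (∑-mono (λ i → c≤1 (suc (suc i)))) (≤-reflexive (trans (∑-const K 1) (*-identityʳ K)))

    α+β≡k : α + β ≡ k
    α+β≡k = begin
      α + β                 ≡⟨ cong₂ _+_ (*-identityʳ α) (*-identityʳ β) ⟨
      α * 1 + β * 1         ≡⟨ ∑-byClass c (λ _ → 1) ⟨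
      ∑[ P < suc (suc K) ] (c P * 1) ≡⟨ sum-cong-≗ (λ P → *-identityʳ (c P)) ⟩
      ∑[ P < suc (suc K) ] c P       ≡⟨ ∑-profile sizes S ⟩
      ∣ S ∣                 ≡⟨ isKClique⇒∣S∣≡k G S clique ⟩
      k                     ∎

    diagonal : ∑[ P < suc (suc K) ] (c P * c P * partWeight P P) ≡ α * 0 + β * (2 * j)
    diagonal = trans (∑-byClass (λ P → c P * c P) (λ t → classWeight t t))
                     (cong₂ (λ u v → u * 0 + v * (2 * j))
                            (cong₂ _+_ (x≤1⇒x*x≡x (c≤1 zero)) (x≤1⇒x*x≡x (c≤1 (suc zero))))
                            (sum-cong-≗ (λ i → x≤1⇒x*x≡x (c≤1 (suc (suc i))))))

    weight-identity : weightWithin G W S + (α * 0 + β * (2 * j))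
                    ≡ α * (α * 0 + β * (2 * suc j)) + β * (α * (2 * suc j) + β * (2 * j))
    weight-identity = begin
      weightWithin G W S + (α * 0 + β * (2 * j))
        ≡⟨ cong₂ _+_ (sym (weightWithin-completeMultipartite sizes partWeight S)) diagonal ⟨
      quadForm c (offDiagonal partWeight) + ∑[ P < suc (suc K) ] (c P * c P * partWeight P P)
        ≡⟨ quadForm-offDiagonal c partWeight ⟩
      quadForm c partWeight
        ≡⟨ quadForm-byClass c classWeight ⟩
      α * (α * 0 + β * (2 * suc j)) + β * (α * (2 * suc j) + β * (2 * j)) ∎

  quadForm-sizes : ∀ (ω : Bool → Bool → ℕ) →
    quadForm sizes (offDiagonal (λ P Q → ω (isLarge P) (isLarge Q))) + ((a * a + a * a) * ω true true + K * (b * b) * ω false false)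
      ≡ (a + a) * ((a + a) * ω true true  + K * b * ω true false)
      + K * b   * ((a + a) * ω false true + K * b * ω false false)
  quadForm-sizes ω = begin
    quadForm sizes (offDiagonal w) + ((a * a + a * a) * ω true true + K * (b * b) * ω false false)
      ≡⟨ cong (quadForm sizes (offDiagonal w) +_) diagonal ⟨
    quadForm sizes (offDiagonal w) + ∑[ P < suc (suc K) ] (sizes P * sizes P * w P P)
      ≡⟨ quadForm-offDiagonal sizes w ⟩
    quadForm sizes w
      ≡⟨ quadForm-byClass sizes ω ⟩
    _ ≡⟨ cong (λ m → (a + a) * ((a + a) * ω true true + m * ω true false) + m * ((a + a) * ω false true + m * ω false false))
              (∑-const K b) ⟩
    _ ∎
    where
    w : Fin (suc (suc K)) → Fin (suc (suc K)) → ℕ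
    w P Q = ω (isLarge P) (isLarge Q)

    diagonal : ∑[ P < suc (suc K) ] (sizes P * sizes P * w P P) ≡ (a * a + a * a) * ω true true + K * (b * b) * ω false false
    diagonal = trans (∑-byClass (λ P → sizes P * sizes P) (λ t → ω t t))
                     (cong (λ m → (a * a + a * a) * ω true true + m * ω false false) (∑-const K (b * b)))

  degree-bound : b ≤ a → ∀ v → n ≤ degree G v + a
  degree-bound b≤a v = subst (_≤ degree G v + a) (degree-completeMultipartite sizes v)
                             (+-monoʳ-≤ (degree G v) (sizes≤a (part sizes v)))
    where
    sizes≤a : ∀ P → sizes P ≤ a
    sizes≤a zero          = ≤-refl
    sizes≤a (suc zero)    = ≤-refl
    sizes≤a (suc (suc _)) = b≤a

  twice-numEdges-identity : 2 * numEdges G + ((a * a + a * a) * 1 + K * (b * b) * 1)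
      ≡ (a + a) * ((a + a) * 1 + K * b * 1) + K * b * ((a + a) * 1 + K * b * 1)
  twice-numEdges-identity =
    trans (cong (_+ ((a * a + a * a) * 1 + K * (b * b) * 1)) (twice-numEdges-completeMultipartite sizes)) (quadForm-sizes (λ _ _ → 1))

  totalWeight-identity : totalWeight G W + ((a * a + a * a) * 0 + K * (b * b) * (2 * j))
      ≡ (a + a) * ((a + a) * 0 + K * b * (2 * suc j)) + K * b * ((a + a) * (2 * suc j) + K * b * (2 * j))
  totalWeight-identity =
    trans (cong (_+ ((a * a + a * a) * 0 + K * (b * b) * (2 * j))) (totalWeight-completeMultipartite sizes partWeight))
          (quadForm-sizes classWeight)

module RationalBounds where

  open import Data.Nat as ℕ using (ℕ; suc)
  open import Data.Nat.Coprimality using (Coprime; 1-coprimeTo)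
  import Data.Nat.Coprimality as Coprimality
  open import Data.Integer as ℤ using (+_; +[1+_])
  import Data.Integer.Properties as ℤ
  open import Data.Rational
    using (ℚ; mkℚ; _+_; _*_; _-_; -_; _≤_; _/_; 1/_; 1ℚ; *≤*; nonNegative; Positive; NonNegative)
  open import Data.Rational.Properties
  open import Data.Rational.Solver using (module +-*-Solver)
  open import Relation.Binary.PropositionalEquality using (_≡_; refl; cong; cong₂; subst) renaming (sym to ≡-sym; trans to ≡-trans)
  open +-*-Solver
  open NatToRational

  private
    recip≡1/ : ∀ m → + 1 / suc m ≡ 1/ (mkℚ +[1+ m ] 0 (Coprimality.sym (1-coprimeTo (suc m))))
    recip≡1/ m = normalize-coprime {1} {m} (1-coprimeTo (suc m))

    recip-nonNeg : ∀ M .{{_ : ℕ.NonZero M}} → NonNegative (+ 1 / M)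
    recip-nonNeg M = normalize-nonNeg 1 M

  ℕ→ℚ*recip≡1 : ∀ M .{{_ : ℕ.NonZero M}} → ℕ→ℚ M * (+ 1 / M) ≡ 1ℚ
  ℕ→ℚ*recip≡1 (suc m) = ≡-trans (cong₂ _*_ (ℕ→ℚ≡mkℚ (suc m)) (recip≡1/ m))
                          (*-inverseʳ (mkℚ +[1+ m ] 0 (Coprimality.sym (1-coprimeTo (suc m)))))

  ≤-*-recip : ∀ M .{{_ : ℕ.NonZero M}} {x y} → M ℕ.* y ℕ.≤ x → ℕ→ℚ y ≤ ℕ→ℚ x * (+ 1 / M)
  ≤-*-recip M {x} {y} My≤x = begin
    ℕ→ℚ y
      ≡⟨ ≡-sym (*-identityʳ (ℕ→ℚ y)) ⟩
    ℕ→ℚ y * 1ℚ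
      ≡⟨ cong (ℕ→ℚ y *_) (≡-sym (ℕ→ℚ*recip≡1 M)) ⟩
    ℕ→ℚ y * (ℕ→ℚ M * (+ 1 / M))
      ≡⟨ ≡-trans (≡-sym (*-assoc (ℕ→ℚ y) (ℕ→ℚ M) (+ 1 / M))) (cong (_* (+ 1 / M)) (*-comm (ℕ→ℚ y) (ℕ→ℚ M))) ⟩
    ℕ→ℚ M * ℕ→ℚ y * (+ 1 / M)
      ≡⟨ cong (_* (+ 1 / M)) (≡-sym (ℕ→ℚ-* M y)) ⟩
    ℕ→ℚ (M ℕ.* y) * (+ 1 / M)
      ≤⟨ *-monoʳ-≤-nonNeg (+ 1 / M) {{recip-nonNeg M}} (ℕ→ℚ-mono-≤ My≤x) ⟩
    ℕ→ℚ x * (+ 1 / M) ∎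
    where open ≤-Reasoning

  recip-*-≤ : ∀ M .{{_ : ℕ.NonZero M}} {x y} → x ℕ.≤ M ℕ.* y → (+ 1 / M) * ℕ→ℚ x ≤ ℕ→ℚ y
  recip-*-≤ M {x} {y} x≤My = begin
    (+ 1 / M) * ℕ→ℚ x
      ≤⟨ *-monoˡ-≤-nonNeg (+ 1 / M) {{recip-nonNeg M}} (ℕ→ℚ-mono-≤ x≤My) ⟩
    (+ 1 / M) * ℕ→ℚ (M ℕ.* y)
      ≡⟨ cong ((+ 1 / M) *_) (ℕ→ℚ-* M y) ⟩
    (+ 1 / M) * (ℕ→ℚ M * ℕ→ℚ y)
      ≡⟨ ≡-trans (≡-sym (*-assoc (+ 1 / M) (ℕ→ℚ M) (ℕ→ℚ y))) (cong (_* ℕ→ℚ y) (*-comm (+ 1 / M) (ℕ→ℚ M))) ⟩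
    ℕ→ℚ M * (+ 1 / M) * ℕ→ℚ y
      ≡⟨ cong (_* ℕ→ℚ y) (ℕ→ℚ*recip≡1 M) ⟩
    1ℚ * ℕ→ℚ y
      ≡⟨ *-identityˡ (ℕ→ℚ y) ⟩
    ℕ→ℚ y ∎
    where open ≤-Reasoning

  1≤pos*denominator : ∀ x d .(c : Coprime (suc x) (suc d)) → 1ℚ ≤ mkℚ +[1+ x ] d c * ℕ→ℚ (suc d)
  1≤pos*denominator x d c = begin
    1ℚ                                ≡⟨ ≡-sym (≡-trans (*-comm (+ 1 / suc d) (ℕ→ℚ (suc d))) (ℕ→ℚ*recip≡1 (suc d))) ⟩
    (+ 1 / suc d) * ℕ→ℚ (suc d)       ≤⟨ *-monoʳ-≤-nonNeg (ℕ→ℚ (suc d)) {{nonNegative (0≤ℕ→ℚ (suc d))}} recip≤ ⟩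
    mkℚ +[1+ x ] d c * ℕ→ℚ (suc d)    ∎
    where
    open ≤-Reasoning
    recip≤ : + 1 / suc d ≤ mkℚ +[1+ x ] d c
    recip≤ = subst (_≤ mkℚ +[1+ x ] d c) (≡-sym (recip≡1/ d))
                   (*≤* (ℤ.*-monoʳ-≤-nonNeg +[1+ d ] (ℤ.+≤+ {1} {suc x} (ℕ.s≤s ℕ.z≤n))))

  minDegree-bound : ∀ (n deg a : ℕ) (u ε : ℚ) → n ℕ.≤ deg ℕ.+ a → ℕ→ℚ a ≤ ℕ→ℚ n * u + ε * ℕ→ℚ n →
    ℕ→ℚ n * (1ℚ - u) - ε * ℕ→ℚ n ≤ ℕ→ℚ deg
  minDegree-bound n deg a u ε n≤deg+a a≤ = begin
    ℕ→ℚ n * (1ℚ - u) - ε * ℕ→ℚ n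
      ≡⟨ solve 3 (λ n u ε → n :* (con 1ℚ :- u) :- ε :* n := n :- (n :* u :+ ε :* n)) refl (ℕ→ℚ n) u ε ⟩
    ℕ→ℚ n - (ℕ→ℚ n * u + ε * ℕ→ℚ n)
      ≤⟨ +-monoʳ-≤ (ℕ→ℚ n) (neg-antimono-≤ a≤) ⟩
    ℕ→ℚ n - ℕ→ℚ a
      ≤⟨ +-monoˡ-≤ (- ℕ→ℚ a) (subst (ℕ→ℚ n ≤_) (ℕ→ℚ-+ deg a) (ℕ→ℚ-mono-≤ n≤deg+a)) ⟩
    ℕ→ℚ deg + ℕ→ℚ a - ℕ→ℚ a
      ≡⟨ solve 2 (λ d a → d :+ a :- a := d) refl (ℕ→ℚ deg) (ℕ→ℚ a) ⟩
    ℕ→ℚ deg ∎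
    where open ≤-Reasoning

  packing-bound : ∀ (v δ : ℚ) (C D W e t : ℕ) → 0 ℕ.< D → v * ℕ→ℚ D ≤ ℕ→ℚ W →
    W ℕ.* C ℕ.+ t ℕ.* D ≡ e ℕ.* D → δ * ℕ→ℚ e ≤ ℕ→ℚ t → v * ℕ→ℚ C ≤ (1ℚ - δ) * ℕ→ℚ e
  packing-bound v δ C D@(suc D′) W e t _ vD≤W identity δe≤t =
    *-cancelʳ-≤-pos (ℕ→ℚ D) {{subst Positive (≡-sym (ℕ→ℚ≡mkℚ D)) _}} (begin
      v * ℕ→ℚ C * ℕ→ℚ D
        ≡⟨ solve 3 (λ v c d → v :* c :* d := v :* d :* c) refl v (ℕ→ℚ C) (ℕ→ℚ D) ⟩
      v * ℕ→ℚ D * ℕ→ℚ C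
        ≤⟨ *-monoʳ-≤-nonNeg (ℕ→ℚ C) {{nonNegative (0≤ℕ→ℚ C)}} vD≤W ⟩
      ℕ→ℚ W * ℕ→ℚ C
        ≡⟨ ≡-sym (ℕ→ℚ-* W C) ⟩
      ℕ→ℚ (W ℕ.* C)
        ≡⟨ solve 2 (λ w t → w := w :+ t :- t) refl (ℕ→ℚ (W ℕ.* C)) (ℕ→ℚ (t ℕ.* D)) ⟩
      ℕ→ℚ (W ℕ.* C) + ℕ→ℚ (t ℕ.* D) - ℕ→ℚ (t ℕ.* D)
        ≡⟨ cong (_- ℕ→ℚ (t ℕ.* D)) (≡-trans (≡-sym (ℕ→ℚ-+ (W ℕ.* C) (t ℕ.* D))) (cong ℕ→ℚ identity)) ⟩
      ℕ→ℚ (e ℕ.* D) - ℕ→ℚ (t ℕ.* D)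
        ≡⟨ cong₂ _-_ (ℕ→ℚ-* e D) (ℕ→ℚ-* t D) ⟩
      ℕ→ℚ e * ℕ→ℚ D - ℕ→ℚ t * ℕ→ℚ D
        ≤⟨ +-monoʳ-≤ (ℕ→ℚ e * ℕ→ℚ D) (neg-antimono-≤ (*-monoʳ-≤-nonNeg (ℕ→ℚ D) {{nonNegative (0≤ℕ→ℚ D)}} δe≤t)) ⟩
      ℕ→ℚ e * ℕ→ℚ D - δ * ℕ→ℚ e * ℕ→ℚ D
        ≡⟨ solve 3 (λ e d δ → e :* d :- δ :* e :* d := (con 1ℚ :- δ) :* e :* d) refl (ℕ→ℚ e) (ℕ→ℚ D) δ ⟩
      (1ℚ - δ) * ℕ→ℚ e * ℕ→ℚ D ∎)
    where open ≤-Reasoning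

module ExtremalGraph (j q : ℕ) where

  open import Data.Nat as ℕ using (ℕ; zero; suc)
  import Data.Nat.Properties as ℕ
  open import Data.Nat.Combinatorics using (_C_; nC1≡n; nCk+nC[k+1]≡[n+1]C[k+1])
  open import Data.Nat.Tactic.RingSolver using (solve-∀)
  open import Data.Integer using (+_)
  open import Data.Rational using (ℚ; _+_; _*_; _-_; _≤_; _<_; _/_; 0ℚ; 1ℚ; nonNegative)
  open import Data.Rational.Properties
    using (positive⁻¹; normalize-pos; +-mono-≤; *-monoʳ-≤-nonNeg; *-monoˡ-≤-nonNeg; *-identityˡ; *-assoc; module ≤-Reasoning)
  open import Relation.Binary.PropositionalEquality
  open GraphCounting using (totalWeight; numEdges≤n*n)
  open Duality using (packingValue*D≤totalWeight)
  open NatToRational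
  open RationalBounds

  twice-C2 : ∀ m → 2 ℕ.* (suc m C 2) ≡ suc m ℕ.* m
  twice-C2 zero    = refl
  twice-C2 (suc m) = begin
    2 ℕ.* (suc (suc m) C 2)                   ≡⟨ cong (2 ℕ.*_) (nCk+nC[k+1]≡[n+1]C[k+1] (suc m) 1) ⟨
    2 ℕ.* (suc m C 1 ℕ.+ suc m C 2)           ≡⟨ cong (λ c → 2 ℕ.* (c ℕ.+ suc m C 2)) (nC1≡n (suc m)) ⟩
    2 ℕ.* (suc m ℕ.+ suc m C 2)               ≡⟨ ℕ.*-distribˡ-+ 2 (suc m) (suc m C 2) ⟩
    2 ℕ.* suc m ℕ.+ 2 ℕ.* (suc m C 2)         ≡⟨ cong (2 ℕ.* suc m ℕ.+_) (twice-C2 m) ⟩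
    2 ℕ.* suc m ℕ.+ suc m ℕ.* m               ≡⟨ arrange m ⟩
    suc (suc m) ℕ.* suc m                     ∎
    where
    open ≡-Reasoning
    arrange : ∀ m → 2 ℕ.* suc m ℕ.+ suc m ℕ.* m ≡ suc (suc m) ℕ.* suc m
    arrange = solve-∀

  Nq : ℕ
  Nq = suc (suc (suc (suc (suc (suc j))) ℕ.* q))

  δ : ℚ
  δ = + 1 / (Nq ℕ.* Nq)

  0<δ : 0ℚ < δ
  0<δ = positive⁻¹ δ {{normalize-pos 1 (Nq ℕ.* Nq)}}

  module Scaled (s : ℕ) where

    b a : ℕ
    b = q ℕ.* s
    a = b ℕ.+ s

    open TwoLargeParts j a b public

    n≡[k+1]b+2s : n ≡ suc k ℕ.* b ℕ.+ 2 ℕ.* s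
    n≡[k+1]b+2s = trans (cong (λ m → a ℕ.+ (a ℕ.+ m)) (∑-const K b)) (arrange j q s)
      where
      open FinSum using (∑-const)
      arrange : ∀ j q s → q ℕ.* s ℕ.+ s ℕ.+ (q ℕ.* s ℕ.+ s ℕ.+ suc (suc j) ℕ.* (q ℕ.* s))
                        ≡ suc (suc (suc (suc j))) ℕ.* (q ℕ.* s) ℕ.+ 2 ℕ.* s
      arrange = solve-∀

    n≡s*Nq : n ≡ s ℕ.* Nq
    n≡s*Nq = trans n≡[k+1]b+2s (arrange j q s)
      where
      arrange : ∀ j q s → suc (suc (suc (suc j))) ℕ.* (q ℕ.* s) ℕ.+ 2 ℕ.* s ≡ s ℕ.* suc (suc (suc (suc (suc (suc j))) ℕ.* q))
      arrange = solve-∀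

    s≤n : s ℕ.≤ n
    s≤n = subst (s ℕ.≤_) (sym n≡s*Nq) (ℕ.m≤m*n s Nq)

    minDegree : (ε : ℚ) → 0ℚ ≤ ε → 1ℚ ≤ ε * ℕ→ℚ q → ∀ v →
      ℕ→ℚ n * (1ℚ - + 1 / suc k) - ε * ℕ→ℚ n ≤ ℕ→ℚ (degree G v)
    minDegree ε 0≤ε 1≤εq v =
      minDegree-bound n (degree G v) a (+ 1 / suc k) ε (degree-bound (ℕ.m≤m+n b s) v)
                      (subst (_≤ ℕ→ℚ n * (+ 1 / suc k) + ε * ℕ→ℚ n) (sym (ℕ→ℚ-+ b s))
                             (+-mono-≤ (≤-*-recip (suc k) {n} {b} [k+1]b≤n) s≤εn))
      where
      open ≤-Reasoning

      [k+1]b≤n : suc k ℕ.* b ℕ.≤ n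
      [k+1]b≤n = subst (suc k ℕ.* b ℕ.≤_) (sym n≡[k+1]b+2s) (ℕ.m≤m+n _ _)

      s≤εn : ℕ→ℚ s ≤ ε * ℕ→ℚ n
      s≤εn = begin
        ℕ→ℚ s             ≡⟨ sym (*-identityˡ (ℕ→ℚ s)) ⟩
        1ℚ * ℕ→ℚ s        ≤⟨ *-monoʳ-≤-nonNeg (ℕ→ℚ s) {{nonNegative (0≤ℕ→ℚ s)}} 1≤εq ⟩
        ε * ℕ→ℚ q * ℕ→ℚ s ≡⟨ trans (*-assoc ε (ℕ→ℚ q) (ℕ→ℚ s)) (cong (ε *_) (sym (ℕ→ℚ-* q s))) ⟩
        ε * ℕ→ℚ b         ≤⟨ *-monoˡ-≤-nonNeg ε {{nonNegative 0≤ε}} (ℕ→ℚ-mono-≤ (ℕ.≤-trans (ℕ.m≤n*m b (suc k)) [k+1]b≤n)) ⟩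
        ε * ℕ→ℚ n         ∎

    totalWeight*C+s²D≡e*D : totalWeight G W ℕ.* (k C 2) ℕ.+ s ℕ.* s ℕ.* D ≡ numEdges G ℕ.* D
    totalWeight*C+s²D≡e*D = ℕ.*-cancelˡ-≡ _ _ 2 (ℕ.+-cancelʳ-≡ (X ℕ.* (2 ℕ.* Cₖ) ℕ.+ U ℕ.* D) _ _ (begin
      2 ℕ.* (T ℕ.* Cₖ ℕ.+ s ℕ.* s ℕ.* D) ℕ.+ (X ℕ.* (2 ℕ.* Cₖ) ℕ.+ U ℕ.* D)
        ≡⟨ regroupT T X Cₖ U s D ⟩
      (T ℕ.+ X) ℕ.* (2 ℕ.* Cₖ) ℕ.+ (2 ℕ.* (s ℕ.* s ℕ.* D) ℕ.+ U ℕ.* D)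
        ≡⟨ cong₂ (λ y c → y ℕ.* c ℕ.+ (2 ℕ.* (s ℕ.* s ℕ.* D) ℕ.+ U ℕ.* D)) totalWeight-identity (twice-C2 K) ⟩
      Y ℕ.* (k ℕ.* K) ℕ.+ (2 ℕ.* (s ℕ.* s ℕ.* D) ℕ.+ U ℕ.* D)
        ≡⟨ polynomial j q s ⟩
      V ℕ.* D ℕ.+ X ℕ.* (k ℕ.* K)
        ≡⟨ cong₂ (λ v c → v ℕ.* D ℕ.+ X ℕ.* c) twice-numEdges-identity (twice-C2 K) ⟨
      (2 ℕ.* E ℕ.+ U) ℕ.* D ℕ.+ X ℕ.* (2 ℕ.* Cₖ)
        ≡⟨ regroupE E X Cₖ U D ⟩
      2 ℕ.* (E ℕ.* D) ℕ.+ (X ℕ.* (2 ℕ.* Cₖ) ℕ.+ U ℕ.* D) ∎))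
      where
      open ≡-Reasoning
      T E Cₖ X Y U V : ℕ
      T = totalWeight G W
      E = numEdges G
      Cₖ = k C 2
      X = (a ℕ.* a ℕ.+ a ℕ.* a) ℕ.* 0 ℕ.+ K ℕ.* (b ℕ.* b) ℕ.* (2 ℕ.* j)
      Y = (a ℕ.+ a) ℕ.* ((a ℕ.+ a) ℕ.* 0 ℕ.+ K ℕ.* b ℕ.* (2 ℕ.* suc j))
        ℕ.+ K ℕ.* b ℕ.* ((a ℕ.+ a) ℕ.* (2 ℕ.* suc j) ℕ.+ K ℕ.* b ℕ.* (2 ℕ.* j))
      U = (a ℕ.* a ℕ.+ a ℕ.* a) ℕ.* 1 ℕ.+ K ℕ.* (b ℕ.* b) ℕ.* 1
      V = (a ℕ.+ a) ℕ.* ((a ℕ.+ a) ℕ.* 1 ℕ.+ K ℕ.* b ℕ.* 1) ℕ.+ K ℕ.* b ℕ.* ((a ℕ.+ a) ℕ.* 1 ℕ.+ K ℕ.* b ℕ.* 1)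

      regroupT : ∀ T X c U s D → 2 ℕ.* (T ℕ.* c ℕ.+ s ℕ.* s ℕ.* D) ℕ.+ (X ℕ.* (2 ℕ.* c) ℕ.+ U ℕ.* D)
                               ≡ (T ℕ.+ X) ℕ.* (2 ℕ.* c) ℕ.+ (2 ℕ.* (s ℕ.* s ℕ.* D) ℕ.+ U ℕ.* D)
      regroupT = solve-∀

      regroupE : ∀ E X c U D → (2 ℕ.* E ℕ.+ U) ℕ.* D ℕ.+ X ℕ.* (2 ℕ.* c) ≡ 2 ℕ.* (E ℕ.* D) ℕ.+ (X ℕ.* (2 ℕ.* c) ℕ.+ U ℕ.* D)
      regroupE = solve-∀

      polynomial : ∀ j q s →
        let b = q ℕ.* s ; a = b ℕ.+ s ; K = suc (suc j) ; k = suc K ; D = 2 ℕ.* (K ℕ.* K ℕ.* suc j)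
            X = (a ℕ.* a ℕ.+ a ℕ.* a) ℕ.* 0 ℕ.+ K ℕ.* (b ℕ.* b) ℕ.* (2 ℕ.* j)
            Y = (a ℕ.+ a) ℕ.* ((a ℕ.+ a) ℕ.* 0 ℕ.+ K ℕ.* b ℕ.* (2 ℕ.* suc j))
              ℕ.+ K ℕ.* b ℕ.* ((a ℕ.+ a) ℕ.* (2 ℕ.* suc j) ℕ.+ K ℕ.* b ℕ.* (2 ℕ.* j))
            U = (a ℕ.* a ℕ.+ a ℕ.* a) ℕ.* 1 ℕ.+ K ℕ.* (b ℕ.* b) ℕ.* 1
            V = (a ℕ.+ a) ℕ.* ((a ℕ.+ a) ℕ.* 1 ℕ.+ K ℕ.* b ℕ.* 1) ℕ.+ K ℕ.* b ℕ.* ((a ℕ.+ a) ℕ.* 1 ℕ.+ K ℕ.* b ℕ.* 1)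
        in Y ℕ.* (k ℕ.* K) ℕ.+ (2 ℕ.* (s ℕ.* s ℕ.* D) ℕ.+ U ℕ.* D) ≡ V ℕ.* D ℕ.+ X ℕ.* (k ℕ.* K)
      polynomial = solve-∀

    noDenseFractionalPacking : ∀ (P : FractionalPacking G k) →
      packingValue G P * ℕ→ℚ (k C 2) ≤ (1ℚ - δ) * ℕ→ℚ (numEdges G)
    noDenseFractionalPacking P =
      packing-bound (packingValue G P) δ (k C 2) D (totalWeight G W) (numEdges G) (s ℕ.* s)
                    (ℕ.s≤s ℕ.z≤n) (packingValue*D≤totalWeight G k W D heavyCliques P) totalWeight*C+s²D≡e*D
                    (recip-*-≤ (Nq ℕ.* Nq) {numEdges G} {s ℕ.* s} e≤Nq²s²)
      where
      e≤Nq²s² : numEdges G ℕ.≤ Nq ℕ.* Nq ℕ.* (s ℕ.* s)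
      e≤Nq²s² = subst (numEdges G ℕ.≤_) (trans (cong (λ m → m ℕ.* m) n≡s*Nq) (arrange s Nq)) (numEdges≤n*n G)
        where
        arrange : ∀ s N → s ℕ.* N ℕ.* (s ℕ.* N) ≡ N ℕ.* N ℕ.* (s ℕ.* s)
        arrange = solve-∀

open import Data.Nat using (ℕ; suc; _≥_)
open import Data.Nat.Combinatorics using (_C_)
open import Data.Fin using (Fin)
open import Data.Integer using (+_)
open import Data.Product using (Σ; _×_)
open import Data.Rational using (ℚ; _<_; _≤_; _-_; _*_; _/_; 0ℚ; 1ℚ)
open import Data.Nat using (z≤n; s≤s)
open import Data.Nat.Properties using (≤-trans; n≤1+n)
open import Data.Integer using (+[1+_]; +0; -[1+_]; +<+)
open import Data.Rational using (mkℚ; *<*)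
open import Data.Rational.Properties using (<⇒≤)
open import Data.Product using (_,_)
open RationalBounds using (1≤pos*denominator)

mainTheorem8 : (k : ℕ) → k ≥ 3 →
    (ε : ℚ) → 0ℚ < ε →
    Σ ℚ (λ δ → 0ℚ < δ ×
      ((N : ℕ) → Σ ℕ (λ n → n ≥ N × Σ (Graph n) (λ G →
        ((v : Fin n) →
          ℕ→ℚ n * (1ℚ - + 1 / suc k) - ε * ℕ→ℚ n ≤ ℕ→ℚ (degree G v))
        × ((P : FractionalPacking G k) →
          packingValue G P * ℕ→ℚ (k C 2) ≤ (1ℚ - δ) * ℕ→ℚ (numEdges G))))))
mainTheorem8 (suc (suc (suc j))) (s≤s (s≤s (s≤s z≤n))) ε@(mkℚ +[1+ x ] d coprime) 0<ε =
  δ , 0<δ , λ N → let open Scaled (suc N) in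
    n , ≤-trans (n≤1+n N) s≤n , G ,
    minDegree ε (<⇒≤ 0<ε) (1≤pos*denominator x d coprime) , noDenseFractionalPacking
  where open ExtremalGraph j (suc d)
mainTheorem8 (suc (suc (suc _))) _ (mkℚ +0       _ _) (*<* (+<+ ()))
mainTheorem8 (suc (suc (suc _))) _ (mkℚ -[1+ _ ] _ _) (*<* ())
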